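{- Let $\lambda$ be a partition and $i$ a column index with $\lambda'_i=\lambda'_{i+1}$, let $\sigma\in\mathcal{T}(\lambda)$, and let $\eta\in\mathcal{A}^+$. Then $$\mathrm{quinv}(\sigma)-\mathrm{quinv}(\rho_i(\sigma))=\eta(\sigma)-\eta(\delta_i(\sigma))\qquad\text{and}\qquad \mathrm{maj}(\rho_i(\sigma))=\mathrm{maj}(\delta_i(\sigma)).$$
   Context: French Young diagram of $\lambda$ with cells $(r,c)$ (row $r$ from the bottom, column $c$ from the left), $\lambda'_c$ = height of column $c$. A filling $\sigma\in\mathcal{T}(\lambda)$ assigns positive integers to cells; conventions $\sigma(\lambda'_c+1,c)=0$ and $\sigma(0,c)=\infty$ (larger than all integers). A cell $(r,c)$, $2\le r\le\lambda'_c$, is a descent if $\sigma(r,c)>\sigma(r-1,c)$; $\mathrm{maj}(\sigma)=\sum_{\text{descents}}(\lambda'_c-r+1)$. $Q(a,b,c)=1$ iff $a<b<c$ or $b<c<a$ or $c<a<b$ or $a=b\ne c$ (values in $\mathbb{Z}_{\ge0}\cup\{\infty\}$), else $0$. $\mathrm{quinv}(\sigma)$ = number of triples of cells $((r+1,c),(r,c),(r,d))$ with $c<d$, $1\le r\le\lambda'_d$ and $Q(\sigma(r+1,c),\sigma(r,c),\sigma(r,d))=1$. Pattern sets $S_1,\dots,S_8$: $S^*$ = chains $z=w>v>u$, $u\ge z=w>v$, $v>u\ge z=w$; each $S_i$ consists of $S^*$, the chains $z>v\ge w>u$, $u\ge z>v\ge w$ and: $S_1$: $z>w>v>u$, $u>v\ge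 z>w$, $z>u>v\ge w$, $v\ge z>w>u$; $S_2$: $z>w>v>u$, $v>u\ge z>w$, $z>u>v\ge w$, $v\ge z>w>u$; $S_3$: $z>w>u>v$, $u>v\ge z>w$, $z>u>v\ge w$, $v\ge z>w>u$; $S_4$: $z>w>u>v$, $v>u\ge z>w$, $z>u>v\ge w$, $v\ge z>w>u$; $S_5$: $z>w>v>u$, $u>v\ge z>w$, $z>v>u\ge w$, $u\ge z>w>v$; $S_6$: $z>w>u>v$, $u>v\ge z>w$, $z>v>u\ge w$, $u\ge z>w>v$; $S_7$: $z>w>v>u$, $v>u\ge z>w$, $z>v>u\ge w$, $u\ge z>w>v$; $S_8$: $z>w>u>v$, $v>u\ge z>w$, $z>v>u\ge w$, $u\ge z>w>v$. $Q_S(z,w,u,v)=1$ iff $(z,w,u,v)$ satisfies a chain of $S^*$, or one of the six further chains of $S$, or $(w,z,v,u)$ satisfies one of those six chains. $\eta_S(\sigma)$ = number of 4-tuples of cells $(r+1,c),(r+1,d),(r,c),(r,d)$ with $c<d$, $\lambda'_c=\lambda'_d$, $1\le r\le\lambda'_c$, $Q_S(\sigma(r+1,c),\sigma(r+1,d),\sigma(r,c),\sigma(r,d))=1$. $\eta^{(S)}(\sigma)=\eta_S(\sigma)+$ number of triples counted by $\mathrm{quinv}$ with $\lambda'_d<\lambda'_c$. $\mathcal{A}^+=\{\eta^{(S_1)},\dots,\eta^{(S_8)}\}$. Operators (for $h=\lambda'_i=\lambda'_{i+1}$): $\delta_i=\delta_i^h$, where $\delta_i^r(\sigma)$ exchanges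 $\sigma(x,i)$ and $\sigma(x,i+1)$ for all $k\le x\le r$, $k$ being the largest integer in $[1,r]$ with $\sigma(k,i)=\sigma(k,i+1)$ ($k=1$ if none). $\rho_i=\rho_i^h$, where $\rho_i^r(\sigma)$ exchanges $\sigma(x,i)$ and $\sigma(x,i+1)$ for all $k\le x\le r$, $k$ being the largest integer in $[1,r]$ with $Q(\sigma(k,i),\sigma(k-1,i),\sigma(k-1,i+1))=Q(\sigma(k,i+1),\sigma(k-1,i),\sigma(k-1,i+1))$. -}

module Defs where

open import Data.Nat using (ℕ; zero; suc; _+_; _∸_; _<_; _≤_; _<ᵇ_; _≤ᵇ_; _≡ᵇ_; _≤?_)
open import Data.Bool using (Bool; true; false; if_then_else_; _∧_; _∨_; not)
open import Data.List using (List; []; _∷_; length; filter)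
open import Data.List.Relation.Unary.All using (All)
open import Data.List.Relation.Unary.Linked using (Linked)
open import Data.Product using (_×_)

-- Partitions: a partition λ is given by its list of parts (row lengths),
-- weakly decreasing and positive.

IsPartition : List ℕ → Set
IsPartition lam = All (0 <_) lam × Linked (λ a b → b ≤ a) lam

-- λ'_c = height of column c = number of parts ≥ c (for c ≥ 1)
conj : List ℕ → ℕ → ℕ
conj lam c = length (filter (c ≤?_) lam)

ncols : List ℕ → ℕ
ncols []      = 0
ncols (p ∷ _) = p

nrows : List ℕ → ℕ
nrows lam = length lam

-- Fillings: σ r c is the entry in row r (from bottom, 1-based),
-- column c (from left, 1-based).  Only values on cells matter.

Filling : Set
Filling = ℕ → ℕ → ℕ

IsFilling : List ℕ → Filling → Set
IsFilling lam σ = ∀ r c → 1 ≤ c → 1 ≤ r → r ≤ conj lam c → 0 < σ r c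

-- Values ℤ≥0 ∪ {∞} and the conventions σ(λ'_c+1,c)=0, σ(0,c)=∞

data Val : Set where
  fin : ℕ → Val
  ∞   : Val

_<V_ : Val → Val → Bool
fin a <V fin b = a <ᵇ b
fin _ <V ∞     = true
∞     <V _     = false

_=V_ : Val → Val → Bool
fin a =V fin b = a ≡ᵇ b
fin _ =V ∞     = false
∞     =V fin _ = false
∞     =V ∞     = true

ev : List ℕ → Filling → ℕ → ℕ → Val
ev lam σ zero    c = ∞
ev lam σ (suc r) c = if conj lam c <ᵇ suc r then fin 0 else fin (σ (suc r) c)

nv : List ℕ → Filling → ℕ → ℕ → ℕ
nv lam σ r c = if conj lam c <ᵇ r then 0 else σ r c

Q : Val → Val → Val → Bool
Q a b c = ((a <V b) ∧ (b <V c)) ∨ ((b <V c) ∧ (c <V a)) ∨ ((c <V a) ∧ (a <V b))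
        ∨ ((a =V b) ∧ not (b =V c))

sumTo : ℕ → (ℕ → ℕ) → ℕ
sumTo zero    f = 0
sumTo (suc n) f = sumTo n f + f (suc n)

ind : Bool → ℕ
ind true  = 1
ind false = 0

maj : List ℕ → Filling → ℕ
maj lam σ = sumTo (ncols lam) λ c → sumTo (conj lam c) λ r →
  if (2 ≤ᵇ r) ∧ (σ (r ∸ 1) c <ᵇ σ r c) then suc (conj lam c ∸ r) else 0

quinvTriple : List ℕ → Filling → ℕ → ℕ → ℕ → Bool
quinvTriple lam σ r c d =
  (c <ᵇ d) ∧ (1 ≤ᵇ r) ∧ (r ≤ᵇ conj lam d)
  ∧ Q (ev lam σ (suc r) c) (ev lam σ r c) (ev lam σ r d)

quinv : List ℕ → Filling → ℕ
quinv lam σ = sumTo (nrows lam) λ r → sumTo (ncols lam) λ c → sumTo (ncols lam) λ d →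
  ind (quinvTriple lam σ r c d)

quinvUnequal : List ℕ → Filling → ℕ
quinvUnequal lam σ = sumTo (nrows lam) λ r → sumTo (ncols lam) λ c → sumTo (ncols lam) λ d →
  ind (quinvTriple lam σ r c d ∧ (conj lam d <ᵇ conj lam c))

_>ᵇ_ _≥ᵇ_ : ℕ → ℕ → Bool
a >ᵇ b = b <ᵇ a
a ≥ᵇ b = b ≤ᵇ a

data PatternSet : Set where
  S₁ S₂ S₃ S₄ S₅ S₆ S₇ S₈ : PatternSet

Sstar : ℕ → ℕ → ℕ → ℕ → Bool
Sstar z w u v =
     ((z ≡ᵇ w) ∧ (w >ᵇ v) ∧ (v >ᵇ u))
  ∨ ((u ≥ᵇ z) ∧ (z ≡ᵇ w) ∧ (w >ᵇ v))
  ∨ ((v >ᵇ u) ∧ (u ≥ᵇ z) ∧ (z ≡ᵇ w))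

six : PatternSet → ℕ → ℕ → ℕ → ℕ → Bool
six S z w u v =
     ((z >ᵇ v) ∧ (v ≥ᵇ w) ∧ (w >ᵇ u))
  ∨ ((u ≥ᵇ z) ∧ (z >ᵇ v) ∧ (v ≥ᵇ w))
  ∨ spec S
  where
  zwvu zwuv uvzw vuzw zuvw vzwu zvuw uzwv : Bool
  zwvu = (z >ᵇ w) ∧ (w >ᵇ v) ∧ (v >ᵇ u)
  zwuv = (z >ᵇ w) ∧ (w >ᵇ u) ∧ (u >ᵇ v)
  uvzw = (u >ᵇ v) ∧ (v ≥ᵇ z) ∧ (z >ᵇ w)
  vuzw = (v >ᵇ u) ∧ (u ≥ᵇ z) ∧ (z >ᵇ w)
  zuvw = (z >ᵇ u) ∧ (u >ᵇ v) ∧ (v ≥ᵇ w)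
  vzwu = (v ≥ᵇ z) ∧ (z >ᵇ w) ∧ (w >ᵇ u)
  zvuw = (z >ᵇ v) ∧ (v >ᵇ u) ∧ (u ≥ᵇ w)
  uzwv = (u ≥ᵇ z) ∧ (z >ᵇ w) ∧ (w >ᵇ v)
  spec : PatternSet → Bool
  spec S₁ = zwvu ∨ uvzw ∨ zuvw ∨ vzwu
  spec S₂ = zwvu ∨ vuzw ∨ zuvw ∨ vzwu
  spec S₃ = zwuv ∨ uvzw ∨ zuvw ∨ vzwu
  spec S₄ = zwuv ∨ vuzw ∨ zuvw ∨ vzwu
  spec S₅ = zwvu ∨ uvzw ∨ zvuw ∨ uzwv
  spec S₆ = zwuv ∨ uvzw ∨ zvuw ∨ uzwv
  spec S₇ = zwvu ∨ vuzw ∨ zvuw ∨ uzwv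
  spec S₈ = zwuv ∨ vuzw ∨ zvuw ∨ uzwv

QS : PatternSet → ℕ → ℕ → ℕ → ℕ → Bool
QS S z w u v = Sstar z w u v ∨ six S z w u v ∨ six S w z v u

etaS : PatternSet → List ℕ → Filling → ℕ
etaS S lam σ = sumTo (nrows lam) λ r → sumTo (ncols lam) λ c → sumTo (ncols lam) λ d →
  ind ((c <ᵇ d) ∧ (conj lam c ≡ᵇ conj lam d) ∧ (1 ≤ᵇ r) ∧ (r ≤ᵇ conj lam c)
       ∧ QS S (nv lam σ (suc r) c) (nv lam σ (suc r) d) (nv lam σ r c) (nv lam σ r d))

eta : PatternSet → List ℕ → Filling → ℕ
eta S lam σ = etaS S lam σ + quinvUnequal lam σ

-- largest k ∈ [1,r] with P k, or 1 if none
largest : (ℕ → Bool) → ℕ → ℕ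
largest P zero    = 1
largest P (suc n) = if P (suc n) then suc n else largest P n

swapRows : ℕ → ℕ → ℕ → Filling → Filling
swapRows i k r σ x c =
  if (k ≤ᵇ x) ∧ (x ≤ᵇ r)
  then (if c ≡ᵇ i then σ x (suc i) else if c ≡ᵇ suc i then σ x i else σ x c)
  else σ x c

δr : List ℕ → ℕ → ℕ → Filling → Filling
δr lam i r σ = swapRows i (largest (λ k → σ k i ≡ᵇ σ k (suc i)) r) r σ

ρr : List ℕ → ℕ → ℕ → Filling → Filling
ρr lam i r σ = swapRows i (largest cond r) r σ
  where
  cond : ℕ → Bool
  cond k = Q (ev lam σ k i) (ev lam σ (k ∸ 1) i) (ev lam σ (k ∸ 1) (suc i))
        =B Q (ev lam σ k (suc i)) (ev lam σ (k ∸ 1) i) (ev lam σ (k ∸ 1) (suc i))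
    where
    _=B_ : Bool → Bool → Bool
    true  =B b = b
    false =B b = not b

δ : List ℕ → ℕ → Filling → Filling
δ lam i = δr lam i (conj lam i)

ρ : List ℕ → ℕ → Filling → Filling
ρ lam i = ρr lam i (conj lam i)

-- Both ρ_i and δ_i exchange columns i and i+1 in all rows from some k up to their common
-- height h; only the choice of k differs. A statistic summed over columns, or over pairs of
-- columns c < d, is then merely permuted, except at three places: the pair (i, i+1) itself,
-- the boundary row k-1 whose upper neighbour is exchanged but which is not, and the top row h,
-- whose upper neighbours are the zeros above the diagram. For δ_i the two columns agree in row
-- k, so the boundary is invisible; for ρ_i, k is chosen so that Q cannot tell the two entries
-- of row k apart, which makes the boundary terms of quinv and of maj trade places, while above
-- k the failure of that condition is exactly what matches the triples inside (i, i+1) before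
-- and after the swap. At the top row an ascent σ(h,i) < σ(h,i+1) becomes a descent and vice
-- versa, for quinv and for η alike; hence both differences equal [ascent] - [descent], and maj
-- is left unchanged by either operator.

module Submission where

open import Defs
open import Data.Nat using (ℕ; zero; suc; _+_; _*_; _∸_; _≤_; _<_; _<ᵇ_; _≤ᵇ_; _≡ᵇ_; z≤n; s≤s; _≟_; _≤?_)
open import Data.Nat.Properties
open import Data.Bool using (Bool; true; false; _∧_; _∨_; not; _xor_; if_then_else_; T)
open import Data.Bool.Properties using (T-≡; xor-same; ∧-assoc; ∨-comm; ∧-zeroʳ; ∧-identityʳ; ∨-identityʳ)
open import Data.Fin using (Fin; zero; suc; #_)
open import Data.Vec using (Vec; []; _∷_; lookup; tabulate; map)
open import Data.Vec.Properties using (tabulate-cong; lookup-map)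
open import Data.Vec.Relation.Unary.All using (All; []; _∷_)
open import Data.Vec.Relation.Unary.All.Properties using (map⁺; lookup⁻)
open import Data.List using (List; _∷_)
open import Data.List.Properties using (length-filter)
open import Data.List.Relation.Unary.Linked as Linked using (Linked; [-]; _∷_)
open import Data.Integer using (+_; _-_; _⊖_)
open import Data.Integer.Properties using ([+m]-[+n]≡m⊖n; +-cancelˡ-⊖)
open import Data.Product using (Σ; _×_; _,_; proj₁; proj₂)
open import Data.Sum using (inj₁; inj₂)
open import Data.Empty using (⊥-elim)
open import Algebra.Properties.CommutativeSemigroup +-commutativeSemigroup using (interchange; xy∙z≈xz∙y)
open import Function using (_∘_)
open import Function.Bundles using (Equivalence)
open import Relation.Binary.PropositionalEquality
open import Relation.Binary.Definitions using (Tri; tri<; tri≈; tri>)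
open import Relation.Nullary using (¬_; yes; no)

¬T⇒≡false : ∀ {b} → ¬ T b → b ≡ false
¬T⇒≡false {false} _ = refl
¬T⇒≡false {true} ¬t = ⊥-elim (¬t _)

<ᵇ-true : ∀ {m n} → m < n → (m <ᵇ n) ≡ true
<ᵇ-true = Equivalence.to T-≡ ∘ <⇒<ᵇ

<ᵇ-false : ∀ {m n} → n ≤ m → (m <ᵇ n) ≡ false
<ᵇ-false {m} {n} n≤m = ¬T⇒≡false λ t → <⇒≱ (<ᵇ⇒< m n t) n≤m

≡ᵇ-true : ∀ {m n} → m ≡ n → (m ≡ᵇ n) ≡ true
≡ᵇ-true {m} {n} = Equivalence.to T-≡ ∘ ≡⇒≡ᵇ m n

≡ᵇ-false : ∀ {m n} → m ≢ n → (m ≡ᵇ n) ≡ false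
≡ᵇ-false {m} {n} m≢n = ¬T⇒≡false (m≢n ∘ ≡ᵇ⇒≡ m n)

≤ᵇ-true : ∀ {m n} → m ≤ n → (m ≤ᵇ n) ≡ true
≤ᵇ-true {zero} _ = refl
≤ᵇ-true {suc m} m<n = <ᵇ-true m<n

≤ᵇ-false : ∀ {m n} → n < m → (m ≤ᵇ n) ≡ false
≤ᵇ-false {suc m} (s≤s n≤m) = <ᵇ-false n≤m

if-same : ∀ {A : Set} b (x : A) → (if b then x else x) ≡ x
if-same true x = refl
if-same false x = refl

<ᵇ-false⇒≥ : ∀ {m n} → (m <ᵇ n) ≡ false → n ≤ m
<ᵇ-false⇒≥ {m} {n} e = ≮⇒≥ λ m<n → subst T e (<⇒<ᵇ m<n)

suc≡⇒< : ∀ {r k} → suc r ≡ k → r < k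
suc≡⇒< refl = ≤-refl

ind-mono : ∀ {p q} → (T p → T q) → ind p ≤ ind q
ind-mono {false} _ = z≤n
ind-mono {true} {true} _ = ≤-refl
ind-mono {true} {false} f = ⊥-elim (f _)

-- Order types

-- The truth of a comparison-based statement about n naturals depends only on
-- their order type, and every order type is realised by the ranks, which lie below n.

Comparisons : ℕ → Set
Comparisons n = Vec (Vec Bool n) n

ltTable eqTable : ∀ {n} → Vec ℕ n → Comparisons n
ltTable xs = tabulate λ j → tabulate λ l → lookup xs j <ᵇ lookup xs l
eqTable xs = tabulate λ j → tabulate λ l → lookup xs j ≡ᵇ lookup xs l

countBelow : ∀ {m} → ℕ → Vec ℕ m → ℕ
countBelow v [] = 0
countBelow v (x ∷ xs) = ind (x <ᵇ v) + countBelow v xs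

countBelow-≤ : ∀ {m} v (xs : Vec ℕ m) → countBelow v xs ≤ m
countBelow-≤ v [] = z≤n
countBelow-≤ v (x ∷ xs) = +-mono-≤ (ind-mono {x <ᵇ v} {true} _) (countBelow-≤ v xs)

countBelow-mono : ∀ {m a b} → a ≤ b → (xs : Vec ℕ m) → countBelow a xs ≤ countBelow b xs
countBelow-mono a≤b [] = z≤n
countBelow-mono {a = a} {b} a≤b (x ∷ xs) =
  +-mono-≤ (ind-mono λ t → <⇒<ᵇ (<-≤-trans (<ᵇ⇒< x a t) a≤b)) (countBelow-mono a≤b xs)

countBelow-strict : ∀ {m a b} → a < b → (xs : Vec ℕ m) (j : Fin m) → lookup xs j ≡ a →
  countBelow a xs < countBelow b xs
countBelow-strict {a = a} a<b (x ∷ xs) zero refl rewrite <ᵇ-false (≤-refl {a}) | <ᵇ-true a<b =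
  s≤s (countBelow-mono (<⇒≤ a<b) xs)
countBelow-strict {a = a} {b} a<b (x ∷ xs) (suc j) e =
  +-mono-≤-< (ind-mono λ t → <⇒<ᵇ (<-trans (<ᵇ⇒< x a t) a<b)) (countBelow-strict a<b xs j e)

countBelow-entry-< : ∀ {m} (xs : Vec ℕ m) (j : Fin m) → countBelow (lookup xs j) xs < m
countBelow-entry-< (x ∷ xs) zero rewrite <ᵇ-false (≤-refl {x}) = s≤s (countBelow-≤ x xs)
countBelow-entry-< (x ∷ xs) (suc j) =
  +-mono-≤-< (ind-mono {x <ᵇ lookup xs j} {true} _) (countBelow-entry-< xs j)

rank : ∀ {n} → Vec ℕ n → Vec ℕ n
rank xs = map (λ v → countBelow v xs) xs

module _ {n} (xs : Vec ℕ n) (j l : Fin n) where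
  private
    a b ra rb : ℕ
    a = lookup xs j
    b = lookup xs l
    ra = countBelow a xs
    rb = countBelow b xs

  rank-preserves-< : (a <ᵇ b) ≡ (ra <ᵇ rb)
  rank-preserves-< with <-cmp a b
  ... | tri< a<b _ _ = trans (<ᵇ-true a<b) (sym (<ᵇ-true (countBelow-strict a<b xs j refl)))
  ... | tri≈ _ a≡b _ rewrite a≡b = trans (<ᵇ-false (≤-refl {b})) (sym (<ᵇ-false (≤-refl {rb})))
  ... | tri> _ _ b<a = trans (<ᵇ-false (<⇒≤ b<a)) (sym (<ᵇ-false (<⇒≤ (countBelow-strict b<a xs l refl))))

  rank-preserves-≡ : (a ≡ᵇ b) ≡ (ra ≡ᵇ rb)
  rank-preserves-≡ with <-cmp a b
  ... | tri< a<b a≢b _ = trans (≡ᵇ-false a≢b) (sym (≡ᵇ-false (<⇒≢ (countBelow-strict a<b xs j refl))))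
  ... | tri≈ _ a≡b _ = trans (≡ᵇ-true a≡b) (sym (≡ᵇ-true (cong (λ v → countBelow v xs) a≡b)))
  ... | tri> _ a≢b b<a = trans (≡ᵇ-false a≢b) (sym (≡ᵇ-false (≢-sym (<⇒≢ (countBelow-strict b<a xs l refl)))))

ltTable-rank : ∀ {n} (xs : Vec ℕ n) → ltTable xs ≡ ltTable (rank xs)
ltTable-rank xs = tabulate-cong λ j → tabulate-cong λ l →
  trans (rank-preserves-< xs j l) (sym (cong₂ _<ᵇ_ (lookup-map j _ xs) (lookup-map l _ xs)))

eqTable-rank : ∀ {n} (xs : Vec ℕ n) → eqTable xs ≡ eqTable (rank xs)
eqTable-rank xs = tabulate-cong λ j → tabulate-cong λ l →
  trans (rank-preserves-≡ xs j l) (sym (cong₂ _≡ᵇ_ (lookup-map j _ xs) (lookup-map l _ xs)))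

rank-below : ∀ {n} (xs : Vec ℕ n) → All (_< n) (rank xs)
rank-below xs = map⁺ (lookup⁻ (countBelow-entry-< xs))

forallBelow : ℕ → (ℕ → Bool) → Bool
forallBelow zero f = true
forallBelow (suc b) f = forallBelow b f ∧ f b

forallBelow-sound : ∀ b f → forallBelow b f ≡ true → ∀ {x} → x < b → f x ≡ true
forallBelow-sound (suc b) f e x<1+b with forallBelow b f in below | f b in top
forallBelow-sound (suc b) f refl x<1+b | true | true with m<1+n⇒m<n∨m≡n x<1+b
... | inj₁ x<b = forallBelow-sound b f below x<b
... | inj₂ refl = top

forallVecsBelow : (m b : ℕ) → (Vec ℕ m → Bool) → Bool
forallVecsBelow zero b f = f []
forallVecsBelow (suc m) b f = forallBelow b λ x → forallVecsBelow m b (f ∘ (x ∷_))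

forallVecsBelow-sound : ∀ m b f → forallVecsBelow m b f ≡ true → ∀ {xs} → All (_< b) xs → f xs ≡ true
forallVecsBelow-sound zero b f e [] = e
forallVecsBelow-sound (suc m) b f e (x<b ∷ xs<b) =
  forallVecsBelow-sound m b _ (forallBelow-sound b _ e x<b) xs<b

OrderPattern : ℕ → Set
OrderPattern n = Comparisons n → Comparisons n → Bool

_holdsOn_ : ∀ {n} → OrderPattern n → Vec ℕ n → Bool
G holdsOn xs = G (ltTable xs) (eqTable xs)

holds-by-order-type : ∀ {n} (G : OrderPattern n) → forallVecsBelow n n (G holdsOn_) ≡ true →
  ∀ xs → G holdsOn xs ≡ true
holds-by-order-type {n} G check xs =
  trans (cong₂ G (ltTable-rank xs) (eqTable-rank xs)) (forallVecsBelow-sound n n _ check (rank-below xs))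

-- Q (fin a) (fin b) (fin c) computes to QBy _<ᵇ_ _≡ᵇ_ a b c, so a pattern written with Qᵖ,
-- evaluated on the comparison tables of (a, b, …), is literally the statement about Q.
QBy : ∀ {A : Set} → (A → A → Bool) → (A → A → Bool) → A → A → A → Bool
QBy _<_ _≈_ a b c = ((a < b) ∧ (b < c)) ∨ ((b < c) ∧ (c < a)) ∨ ((c < a) ∧ (a < b)) ∨ ((a ≈ b) ∧ not (b ≈ c))

cell : ∀ {n} → Comparisons n → Fin n → Fin n → Bool
cell C x y = lookup (lookup C x) y

Qᵖ : ∀ {n} → Comparisons n → Comparisons n → Fin n → Fin n → Fin n → Bool
Qᵖ L E = QBy (cell L) (cell E)

xor-∨-resolve : ∀ {p q} c → (p xor q) ∨ c ≡ true → p ≡ q → c ≡ true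
xor-∨-resolve {p} c e refl rewrite xor-same p = e

≡ᵇ-true⇒≡ : ∀ {m n} → (m ≡ᵇ n) ≡ true → m ≡ n
≡ᵇ-true⇒≡ {m} {n} e = ≡ᵇ⇒≡ m n (Equivalence.from T-≡ e)

≢⇒≡-or : ∀ {p q r} → not (p xor q) ∨ not (p xor r) ≡ true → p ≢ q → p ≡ r
≢⇒≡-or {true} {true} _ p≢q = ⊥-elim (p≢q refl)
≢⇒≡-or {false} {false} _ p≢q = ⊥-elim (p≢q refl)
≢⇒≡-or {true} {false} {true} _ _ = refl
≢⇒≡-or {false} {true} {false} _ _ = refl

Q-unequal⇒swap : ∀ a a' x y → Q (fin a) (fin x) (fin y) ≢ Q (fin a') (fin x) (fin y) →
  Q (fin a) (fin x) (fin y) ≡ Q (fin a') (fin y) (fin x)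
Q-unequal⇒swap a a' x y ne = ≢⇒≡-or (holds-by-order-type order-type refl (a ∷ a' ∷ x ∷ y ∷ [])) ne
  where
  order-type : OrderPattern 4
  order-type L E = not (Qᵖ L E (# 0) (# 2) (# 3) xor Qᵖ L E (# 1) (# 2) (# 3))
              ∨ not (Qᵖ L E (# 0) (# 2) (# 3) xor Qᵖ L E (# 1) (# 3) (# 2))

Q-exchange : ∀ a a' x y e → Q (fin a) (fin x) (fin y) ≡ Q (fin a') (fin x) (fin y) →
  ind (Q (fin a) (fin x) (fin e)) + ind (Q (fin a') (fin y) (fin e))
  ≡ ind (Q (fin a') (fin x) (fin e)) + ind (Q (fin a) (fin y) (fin e))
Q-exchange a a' x y e h =
  ≡ᵇ-true⇒≡ (xor-∨-resolve _ (holds-by-order-type order-type refl (a ∷ a' ∷ x ∷ y ∷ e ∷ [])) h)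
  where
  order-type : OrderPattern 5
  order-type L E = (Qᵖ L E (# 0) (# 2) (# 3) xor Qᵖ L E (# 1) (# 2) (# 3))
    ∨ ((ind (Qᵖ L E (# 0) (# 2) (# 4)) + ind (Qᵖ L E (# 1) (# 3) (# 4)))
       ≡ᵇ (ind (Qᵖ L E (# 1) (# 2) (# 4)) + ind (Qᵖ L E (# 0) (# 3) (# 4))))

descent-exchange : ∀ a a' x y → Q (fin a) (fin x) (fin y) ≡ Q (fin a') (fin x) (fin y) →
  ind (x <ᵇ a) + ind (y <ᵇ a') ≡ ind (x <ᵇ a') + ind (y <ᵇ a)
descent-exchange a a' x y h = ≡ᵇ-true⇒≡ (xor-∨-resolve _ (holds-by-order-type order-type refl (a ∷ a' ∷ x ∷ y ∷ [])) h)
  where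
  order-type : OrderPattern 4
  order-type L E = (Qᵖ L E (# 0) (# 2) (# 3) xor Qᵖ L E (# 1) (# 2) (# 3))
    ∨ ((ind (cell L (# 2) (# 0)) + ind (cell L (# 3) (# 1))) ≡ᵇ (ind (cell L (# 2) (# 1)) + ind (cell L (# 3) (# 0))))

Q-zero : ∀ x y → 0 < x → 0 < y → Q (fin 0) (fin x) (fin y) ≡ (x <ᵇ y)
Q-zero (suc x) (suc y) _ _ with x <ᵇ y
... | true = refl
... | false = refl

-- Finite sums

sumTo-cong : ∀ n {f g : ℕ → ℕ} → (∀ x → 1 ≤ x → x ≤ n → f x ≡ g x) → sumTo n f ≡ sumTo n g
sumTo-cong zero _ = refl
sumTo-cong (suc n) f≗g =
  cong₂ _+_ (sumTo-cong n λ x 1≤x x≤n → f≗g x 1≤x (m≤n⇒m≤1+n x≤n)) (f≗g (suc n) (s≤s z≤n) ≤-refl)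

sumTo-distrib-+ : ∀ n (f g : ℕ → ℕ) → sumTo n (λ x → f x + g x) ≡ sumTo n f + sumTo n g
sumTo-distrib-+ zero f g = refl
sumTo-distrib-+ (suc n) f g rewrite sumTo-distrib-+ n f g = interchange (sumTo n f) (sumTo n g) (f (suc n)) (g (suc n))

private
  regroup : ∀ s x y a → s + x + y + a ≡ s + (x + y + a)
  regroup s x y a = trans (cong (_+ a) (+-assoc s x y)) (+-assoc s (x + y) a)

sumTo-perturb₁ : ∀ n j {f g : ℕ → ℕ} a b → 1 ≤ j → j ≤ n →
  (∀ x → 1 ≤ x → x ≤ n → x ≢ j → f x ≡ g x) → f j + a ≡ g j + b →
  sumTo n f + a ≡ sumTo n g + b
sumTo-perturb₁ zero j a b 1≤j j≤0 _ _ = ⊥-elim (<⇒≱ 1≤j j≤0)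
sumTo-perturb₁ (suc n) j {f} {g} a b 1≤j j≤1+n f≗g fj with <-cmp j (suc n)
... | tri≈ _ refl _ = begin
  sumTo n f + f j + a   ≡⟨ +-assoc (sumTo n f) (f j) a ⟩
  sumTo n f + (f j + a) ≡⟨ cong₂ _+_ (sumTo-cong n below) fj ⟩
  sumTo n g + (g j + b) ≡⟨ sym (+-assoc (sumTo n g) (g j) b) ⟩
  sumTo n g + g j + b   ∎
  where
  open ≡-Reasoning
  below : ∀ x → 1 ≤ x → x ≤ n → f x ≡ g x
  below x 1≤x x≤n = f≗g x 1≤x (m≤n⇒m≤1+n x≤n) (<⇒≢ (s≤s x≤n))
... | tri< j<1+n _ _ = begin
  sumTo n f + f (suc n) + a ≡⟨ xy∙z≈xz∙y (sumTo n f) (f (suc n)) a ⟩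
  sumTo n f + a + f (suc n) ≡⟨ cong₂ _+_ (sumTo-perturb₁ n j a b 1≤j (≤-pred j<1+n) below fj) top ⟩
  sumTo n g + b + g (suc n) ≡⟨ sym (xy∙z≈xz∙y (sumTo n g) (g (suc n)) b) ⟩
  sumTo n g + g (suc n) + b ∎
  where
  open ≡-Reasoning
  below : ∀ x → 1 ≤ x → x ≤ n → x ≢ j → f x ≡ g x
  below x 1≤x x≤n = f≗g x 1≤x (m≤n⇒m≤1+n x≤n)
  top : f (suc n) ≡ g (suc n)
  top = f≗g (suc n) (s≤s z≤n) ≤-refl (≢-sym (<⇒≢ j<1+n))
... | tri> _ _ 1+n<j = ⊥-elim (<⇒≱ 1+n<j j≤1+n)

sumTo-perturb₂ : ∀ n j {f g : ℕ → ℕ} a b → 1 ≤ j → suc j ≤ n →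
  (∀ x → 1 ≤ x → x ≤ n → x ≢ j → x ≢ suc j → f x ≡ g x) → f j + f (suc j) + a ≡ g j + g (suc j) + b →
  sumTo n f + a ≡ sumTo n g + b
sumTo-perturb₂ (suc n) (suc j) {f} {g} a b _ 2+j≤1+n f≗g fj with <-cmp (suc j) n
... | tri≈ _ refl _ = begin
  sumTo j f + f (suc j) + f (suc (suc j)) + a   ≡⟨ regroup (sumTo j f) (f (suc j)) (f (suc (suc j))) a ⟩
  sumTo j f + (f (suc j) + f (suc (suc j)) + a) ≡⟨ cong₂ _+_ (sumTo-cong j below) fj ⟩
  sumTo j g + (g (suc j) + g (suc (suc j)) + b) ≡⟨ sym (regroup (sumTo j g) (g (suc j)) (g (suc (suc j))) b) ⟩
  sumTo j g + g (suc j) + g (suc (suc j)) + b   ∎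
  where
  open ≡-Reasoning
  below : ∀ x → 1 ≤ x → x ≤ j → f x ≡ g x
  below x 1≤x x≤j =
    f≗g x 1≤x (m≤n⇒m≤1+n (m≤n⇒m≤1+n x≤j)) (<⇒≢ (s≤s x≤j)) (<⇒≢ (s≤s (m≤n⇒m≤1+n x≤j)))
... | tri< 1+j<n _ _ = begin
  sumTo n f + f (suc n) + a ≡⟨ xy∙z≈xz∙y (sumTo n f) (f (suc n)) a ⟩
  sumTo n f + a + f (suc n) ≡⟨ cong₂ _+_ (sumTo-perturb₂ n (suc j) a b (s≤s z≤n) 1+j<n below fj) top ⟩
  sumTo n g + b + g (suc n) ≡⟨ sym (xy∙z≈xz∙y (sumTo n g) (g (suc n)) b) ⟩
  sumTo n g + g (suc n) + b ∎
  where
  open ≡-Reasoning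
  below : ∀ x → 1 ≤ x → x ≤ n → x ≢ suc j → x ≢ suc (suc j) → f x ≡ g x
  below x 1≤x x≤n = f≗g x 1≤x (m≤n⇒m≤1+n x≤n)
  top : f (suc n) ≡ g (suc n)
  top = f≗g (suc n) (s≤s z≤n) ≤-refl (≢-sym (<⇒≢ (m<n⇒m<1+n 1+j<n))) (≢-sym (<⇒≢ (s≤s 1+j<n)))
... | tri> _ _ n<1+j = ⊥-elim (<⇒≱ n<1+j (≤-pred 2+j≤1+n))

sumTo-cong-except-pair : ∀ n j {f g : ℕ → ℕ} → 1 ≤ j → suc j ≤ n →
  (∀ x → 1 ≤ x → x ≤ n → x ≢ j → x ≢ suc j → f x ≡ g x) → f j + f (suc j) ≡ g j + g (suc j) →
  sumTo n f ≡ sumTo n g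
sumTo-cong-except-pair n j {f} {g} 1≤j 1+j≤n f≗g fj =
  +-cancelʳ-≡ 0 (sumTo n f) (sumTo n g) (sumTo-perturb₂ n j 0 0 1≤j 1+j≤n f≗g (cong (_+ 0) fj))

pairSum-perturb : ∀ n j (F G : ℕ → ℕ → ℕ) a b → 1 ≤ j → suc j ≤ n →
  (∀ c d → d ≤ c → F c d ≡ 0) → (∀ c d → d ≤ c → G c d ≡ 0) →
  (∀ c d → c ≢ j → c ≢ suc j → d ≢ j → d ≢ suc j → F c d ≡ G c d) →
  (∀ c → c < j → F c j + F c (suc j) ≡ G c j + G c (suc j)) →
  (∀ d → suc j < d → F j d + F (suc j) d ≡ G j d + G (suc j) d) →
  F j (suc j) + a ≡ G j (suc j) + b →
  sumTo n (λ c → sumTo n (F c)) + a ≡ sumTo n (λ c → sumTo n (G c)) + b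
pairSum-perturb n j F G a b 1≤j 1+j≤n F-upper G-upper off left right inner =
  sumTo-perturb₂ n j a b 1≤j 1+j≤n otherRows pairedRows
  where
  otherRows : ∀ c → 1 ≤ c → c ≤ n → c ≢ j → c ≢ suc j → sumTo n (F c) ≡ sumTo n (G c)
  otherRows c _ _ c≢j c≢1+j with <-cmp c j
  ... | tri< c<j _ _ = sumTo-cong-except-pair n j 1≤j 1+j≤n (λ d _ _ → off c d c≢j c≢1+j) (left c c<j)
  ... | tri≈ _ c≡j _ = ⊥-elim (c≢j c≡j)
  ... | tri> _ _ j<c = sumTo-cong n λ d _ _ → entry d
    where
    entry : ∀ d → F c d ≡ G c d
    entry d with <-cmp d (suc j)
    ... | tri> _ _ 1+j<d =
      off c d c≢j c≢1+j (λ d≡j → <⇒≱ 1+j<d (≤-trans (≤-reflexive d≡j) (n≤1+n j))) (≢-sym (<⇒≢ 1+j<d))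
    ... | tri≈ _ refl _ = trans (F-upper c d j<c) (sym (G-upper c d j<c))
    ... | tri< d<1+j _ _ = trans (F-upper c d d≤c) (sym (G-upper c d d≤c))
      where
      d≤c : d ≤ c
      d≤c = ≤-trans (≤-pred d<1+j) (<⇒≤ j<c)
  pairedRows : sumTo n (F j) + sumTo n (F (suc j)) + a ≡ sumTo n (G j) + sumTo n (G (suc j)) + b
  pairedRows rewrite sym (sumTo-distrib-+ n (F j) (F (suc j))) | sym (sumTo-distrib-+ n (G j) (G (suc j))) =
    sumTo-perturb₁ n (suc j) a b (s≤s z≤n) 1+j≤n column atJ
    where
    column : ∀ d → 1 ≤ d → d ≤ n → d ≢ suc j → F j d + F (suc j) d ≡ G j d + G (suc j) d
    column d _ _ d≢1+j with <-cmp d (suc j)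
    ... | tri< d<1+j _ _ rewrite F-upper j d (≤-pred d<1+j) | G-upper j d (≤-pred d<1+j)
                               | F-upper (suc j) d (<⇒≤ d<1+j) | G-upper (suc j) d (<⇒≤ d<1+j) = refl
    ... | tri≈ _ d≡1+j _ = ⊥-elim (d≢1+j d≡1+j)
    ... | tri> _ _ 1+j<d = right d 1+j<d
    atJ : F j (suc j) + F (suc j) (suc j) + a ≡ G j (suc j) + G (suc j) (suc j) + b
    atJ rewrite F-upper (suc j) (suc j) ≤-refl | G-upper (suc j) (suc j) ≤-refl
              | +-identityʳ (F j (suc j)) | +-identityʳ (G j (suc j)) = inner

-- Exchanging two columns in a range of rows

largest-≤ : ∀ P n → 1 ≤ n → largest P n ≤ n
largest-≤ P (suc n) _ with P (suc n)
... | true = ≤-refl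
largest-≤ P (suc zero) _ | false = ≤-refl
largest-≤ P (suc (suc n)) _ | false = m≤n⇒m≤1+n (largest-≤ P (suc n) (s≤s z≤n))

largest-holds : ∀ P n → 2 ≤ largest P n → P (largest P n) ≡ true
largest-holds P zero (s≤s ())
largest-holds P (suc n) 2≤k with P (suc n) in e
... | true = e
... | false = largest-holds P n 2≤k

largest-maximal : ∀ P n m → largest P n < m → m ≤ n → P m ≡ false
largest-maximal P zero m k<m m≤0 = ⊥-elim (<⇒≱ (<-≤-trans (s≤s z≤n) k<m) m≤0)
largest-maximal P (suc n) m k<m m≤1+n with P (suc n) in e
... | true = ⊥-elim (<⇒≱ k<m m≤1+n)
... | false with m≤n⇒m<n∨m≡n m≤1+n
...   | inj₁ m<1+n = largest-maximal P n m k<m (≤-pred m<1+n)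
...   | inj₂ refl = e

largest-cong : ∀ {P P'} n → (∀ m → P m ≡ P' m) → largest P n ≡ largest P' n
largest-cong zero _ = refl
largest-cong {P} {P'} (suc n) P≗P' rewrite P≗P' (suc n) | largest-cong n P≗P' = refl

colSwap : ℕ → ℕ → ℕ
colSwap i c = if c ≡ᵇ i then suc i else if c ≡ᵇ suc i then i else c

colSwap-left : ∀ i → colSwap i i ≡ suc i
colSwap-left i rewrite ≡ᵇ-true (refl {x = i}) = refl

colSwap-right : ∀ i → colSwap i (suc i) ≡ i
colSwap-right i rewrite ≡ᵇ-false (≢-sym (<⇒≢ (n<1+n i))) | ≡ᵇ-true (refl {x = suc i}) = refl

colSwap-other : ∀ {i c} → c ≢ i → c ≢ suc i → colSwap i c ≡ c
colSwap-other c≢i c≢1+i rewrite ≡ᵇ-false c≢i | ≡ᵇ-false c≢1+i = refl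

module _ (i k r : ℕ) (σ : Filling) where

  swapRows-outside : ∀ {x} c → ((k ≤ᵇ x) ∧ (x ≤ᵇ r)) ≡ false → swapRows i k r σ x c ≡ σ x c
  swapRows-outside c out rewrite out = refl

  swapRows-below : ∀ {x} c → x < k → swapRows i k r σ x c ≡ σ x c
  swapRows-below c x<k = swapRows-outside c (cong (_∧ _) (≤ᵇ-false x<k))

  swapRows-other : ∀ {x c} → c ≢ i → c ≢ suc i → swapRows i k r σ x c ≡ σ x c
  swapRows-other {x} {c} c≢i c≢1+i rewrite ≡ᵇ-false c≢i | ≡ᵇ-false c≢1+i = if-same _ (σ x c)

  swapRows-inside : ∀ {x} c → k ≤ x → x ≤ r → swapRows i k r σ x c ≡ σ x (colSwap i c)
  swapRows-inside {x} c k≤x x≤r rewrite ≤ᵇ-true k≤x | ≤ᵇ-true x≤r with c ≡ᵇ i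
  ... | true = refl
  ... | false with c ≡ᵇ suc i
  ...   | true = refl
  ...   | false = refl

module ColumnSwap (L : List ℕ) (i : ℕ) (equal-heights : conj L i ≡ conj L (suc i)) (σ : Filling) (k : ℕ) where

  h : ℕ
  h = conj L i

  τ : Filling
  τ = swapRows i k h σ

  conj-colSwap : ∀ c → conj L (colSwap i c) ≡ conj L c
  conj-colSwap c with c ≟ i | c ≟ suc i
  ... | yes refl | _ rewrite colSwap-left i = sym equal-heights
  ... | no _ | yes refl rewrite colSwap-right i = equal-heights
  ... | no c≢i | no c≢1+i rewrite colSwap-other c≢i c≢1+i = refl

  τ-inside : ∀ {x} c → k ≤ x → x ≤ conj L c → τ x c ≡ σ x (colSwap i c)
  τ-inside c k≤x x≤hc with c ≟ i | c ≟ suc i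
  ... | yes refl | _ = swapRows-inside i k h σ c k≤x x≤hc
  ... | no _ | yes refl = swapRows-inside i k h σ c k≤x (subst (_ ≤_) (sym equal-heights) x≤hc)
  ... | no c≢i | no c≢1+i = trans (swapRows-other i k h σ c≢i c≢1+i) (cong (σ _) (sym (colSwap-other c≢i c≢1+i)))

  nv-swap-below : ∀ x c → x < k → nv L τ x c ≡ nv L σ x c
  nv-swap-below x c x<k rewrite swapRows-below i k h σ c x<k = refl

  nv-swap-other : ∀ x {c} → c ≢ i → c ≢ suc i → nv L τ x c ≡ nv L σ x c
  nv-swap-other x {c} c≢i c≢1+i rewrite swapRows-other i k h σ {x} c≢i c≢1+i = refl

  nv-swap-above : ∀ x c → k ≤ x → nv L τ x c ≡ nv L σ x (colSwap i c)
  nv-swap-above x c k≤x rewrite conj-colSwap c with conj L c <ᵇ x in e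
  ... | true = refl
  ... | false = τ-inside c k≤x (<ᵇ-false⇒≥ e)

-- Statistics summed over pairs of columns

-- A weight φ r h_c h_d z u v w sees the row r, the heights of the columns c < d, and the entries
-- z = (r+1,c), u = (r,c), v = (r,d), w = (r+1,d).
PairWeight : Set
PairWeight = ℕ → ℕ → ℕ → ℕ → ℕ → ℕ → ℕ → Bool

pairTerm : PairWeight → List ℕ → Filling → ℕ → ℕ → ℕ → ℕ
pairTerm φ L σ r c d = ind ((c <ᵇ d) ∧ φ r (conj L c) (conj L d)
  (nv L σ (suc r) c) (nv L σ r c) (nv L σ r d) (nv L σ (suc r) d))

rowSum : PairWeight → List ℕ → Filling → ℕ → ℕ
rowSum φ L σ r = sumTo (ncols L) λ c → sumTo (ncols L) (pairTerm φ L σ r c)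

pairStat : PairWeight → List ℕ → Filling → ℕ
pairStat φ L σ = sumTo (nrows L) (rowSum φ L σ)

pairTerm-upper : ∀ φ L σ r {c d} → d ≤ c → pairTerm φ L σ r c d ≡ 0
pairTerm-upper φ L σ r d≤c rewrite <ᵇ-false d≤c = refl

pairTerm-cong : ∀ φ L σ σ′ r {c d} →
  nv L σ (suc r) c ≡ nv L σ′ (suc r) c → nv L σ r c ≡ nv L σ′ r c →
  nv L σ r d ≡ nv L σ′ r d → nv L σ (suc r) d ≡ nv L σ′ (suc r) d →
  pairTerm φ L σ r c d ≡ pairTerm φ L σ′ r c d
pairTerm-cong φ L σ σ′ r z u v w rewrite z | u | v | w = refl

module PairSwap (φ : PairWeight) (L : List ℕ) (i : ℕ) (equal-heights : conj L i ≡ conj L (suc i))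
                (σ : Filling) (k : ℕ) where
  open ColumnSwap L i equal-heights σ k

  PairsBalanced : ℕ → Set
  PairsBalanced r =
      (∀ c → c < i → pairTerm φ L σ r c i + pairTerm φ L σ r c (suc i)
                   ≡ pairTerm φ L τ r c i + pairTerm φ L τ r c (suc i))
    × (∀ d → suc i < d → pairTerm φ L σ r i d + pairTerm φ L σ r (suc i) d
                       ≡ pairTerm φ L τ r i d + pairTerm φ L τ r (suc i) d)

  pairTerm-below : ∀ r c d → suc r < k → pairTerm φ L τ r c d ≡ pairTerm φ L σ r c d
  pairTerm-below r c d 1+r<k = pairTerm-cong φ L τ σ r
    (nv-swap-below (suc r) c 1+r<k) (nv-swap-below r c (<-trans (n<1+n r) 1+r<k))
    (nv-swap-below r d (<-trans (n<1+n r) 1+r<k)) (nv-swap-below (suc r) d 1+r<k)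

  pairTerm-other : ∀ r {c d} → c ≢ i → c ≢ suc i → d ≢ i → d ≢ suc i →
    pairTerm φ L σ r c d ≡ pairTerm φ L τ r c d
  pairTerm-other r c≢i c≢1+i d≢i d≢1+i = sym (pairTerm-cong φ L τ σ r
    (nv-swap-other (suc r) c≢i c≢1+i) (nv-swap-other r c≢i c≢1+i)
    (nv-swap-other r d≢i d≢1+i) (nv-swap-other (suc r) d≢i d≢1+i))

  pairTerm-above : ∀ {r} c d {c′ d′} → k ≤ r →
    colSwap i c ≡ c′ → colSwap i d ≡ d′ → (c <ᵇ d) ≡ (c′ <ᵇ d′) →
    pairTerm φ L τ r c d ≡ pairTerm φ L σ r c′ d′
  pairTerm-above {r} c d k≤r refl refl order
    rewrite nv-swap-above r c k≤r | nv-swap-above r d k≤r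
          | nv-swap-above (suc r) c (m≤n⇒m≤1+n k≤r) | nv-swap-above (suc r) d (m≤n⇒m≤1+n k≤r)
          | order | conj-colSwap c | conj-colSwap d = refl

  balanced-below : ∀ {r} → suc r < k → PairsBalanced r
  balanced-below {r} 1+r<k =
    (λ c _ → sym (cong₂ _+_ (pairTerm-below r c i 1+r<k) (pairTerm-below r c (suc i) 1+r<k))) ,
    (λ d _ → sym (cong₂ _+_ (pairTerm-below r i d 1+r<k) (pairTerm-below r (suc i) d 1+r<k)))

  balanced-above : ∀ {r} → k ≤ r → PairsBalanced r
  balanced-above {r} k≤r = left , right
    where
    left : ∀ c → c < i → pairTerm φ L σ r c i + pairTerm φ L σ r c (suc i)
                       ≡ pairTerm φ L τ r c i + pairTerm φ L τ r c (suc i)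
    left c c<i = trans (+-comm (pairTerm φ L σ r c i) _) (sym (cong₂ _+_
      (pairTerm-above c i k≤r c-fixed (colSwap-left i) order)
      (pairTerm-above c (suc i) k≤r c-fixed (colSwap-right i) (sym order))))
      where
      c-fixed : colSwap i c ≡ c
      c-fixed = colSwap-other (<⇒≢ c<i) (<⇒≢ (m<n⇒m<1+n c<i))
      order : (c <ᵇ i) ≡ (c <ᵇ suc i)
      order = trans (<ᵇ-true c<i) (sym (<ᵇ-true (m<n⇒m<1+n c<i)))
    right : ∀ d → suc i < d → pairTerm φ L σ r i d + pairTerm φ L σ r (suc i) d
                            ≡ pairTerm φ L τ r i d + pairTerm φ L τ r (suc i) d
    right d 1+i<d = trans (+-comm (pairTerm φ L σ r i d) _) (sym (cong₂ _+_
      (pairTerm-above i d k≤r (colSwap-left i) d-fixed order)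
      (pairTerm-above (suc i) d k≤r (colSwap-right i) d-fixed (sym order))))
      where
      i<d : i < d
      i<d = <-trans (n<1+n i) 1+i<d
      d-fixed : colSwap i d ≡ d
      d-fixed = colSwap-other (≢-sym (<⇒≢ i<d)) (≢-sym (<⇒≢ 1+i<d))
      order : (i <ᵇ d) ≡ (suc i <ᵇ d)
      order = trans (<ᵇ-true i<d) (sym (<ᵇ-true 1+i<d))

  pairsBalanced : ∀ r → (suc r ≡ k → PairsBalanced r) → PairsBalanced r
  pairsBalanced r mixed with <-cmp (suc r) k
  ... | tri< 1+r<k _ _ = balanced-below 1+r<k
  ... | tri≈ _ 1+r≡k _ = mixed 1+r≡k
  ... | tri> _ _ k<1+r = balanced-above (≤-pred k<1+r)

  rowSum-swap : ∀ r a b → 1 ≤ i → suc i ≤ ncols L → PairsBalanced r →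
    pairTerm φ L σ r i (suc i) + a ≡ pairTerm φ L τ r i (suc i) + b →
    rowSum φ L σ r + a ≡ rowSum φ L τ r + b
  rowSum-swap r a b 1≤i 1+i≤n (left , right) =
    pairSum-perturb (ncols L) i (pairTerm φ L σ r) (pairTerm φ L τ r) a b 1≤i 1+i≤n
      (λ _ _ → pairTerm-upper φ L σ r) (λ _ _ → pairTerm-upper φ L τ r) (λ _ _ → pairTerm-other r) left right

  pairStat-swap : ∀ a b → 1 ≤ i → suc i ≤ ncols L → 1 ≤ h → h ≤ nrows L →
    (∀ r → 1 ≤ r → suc r ≡ k → PairsBalanced r) →
    (∀ r → 1 ≤ r → r ≤ nrows L → r ≢ h → pairTerm φ L σ r i (suc i) ≡ pairTerm φ L τ r i (suc i)) →
    pairTerm φ L σ h i (suc i) + a ≡ pairTerm φ L τ h i (suc i) + b →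
    pairStat φ L σ + a ≡ pairStat φ L τ + b
  pairStat-swap a b 1≤i 1+i≤n 1≤h h≤N mixed inner top =
    sumTo-perturb₁ (nrows L) h a b 1≤h h≤N
      (λ r 1≤r r≤N r≢h → +-cancelʳ-≡ 0 (rowSum φ L σ r) (rowSum φ L τ r)
         (rowSum-swap r 0 0 1≤i 1+i≤n (pairsBalanced r (mixed r 1≤r)) (cong (_+ 0) (inner r 1≤r r≤N r≢h))))
      (rowSum-swap h a b 1≤i 1+i≤n (pairsBalanced h (mixed h 1≤h)) top)

  balanced-rows-fixed : ∀ {r} → (∀ c → nv L σ (suc r) c ≡ nv L τ (suc r) c) → (∀ c → nv L σ r c ≡ nv L τ r c) →
    PairsBalanced r
  balanced-rows-fixed {r} upper lower =
    (λ c _ → cong₂ _+_ (fixed c i) (fixed c (suc i))) , (λ d _ → cong₂ _+_ (fixed i d) (fixed (suc i) d))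
    where
    fixed : ∀ c d → pairTerm φ L σ r c d ≡ pairTerm φ L τ r c d
    fixed c d = pairTerm-cong φ L σ τ r (upper c) (lower c) (lower d) (upper d)

-- quinv, η and ρ in terms of pair statistics

-- The paper's boundary σ(0,c) = ∞, on top of nv's convention σ(λ'_c + 1, c) = 0.
withTop : ℕ → ℕ → Val
withTop zero _ = ∞
withTop (suc _) v = fin v

ev≡withTop-nv : ∀ L σ x c → ev L σ x c ≡ withTop x (nv L σ x c)
ev≡withTop-nv L σ zero c = refl
ev≡withTop-nv L σ (suc x) c with conj L c <ᵇ suc x
... | true = refl
... | false = refl

quinvWeight : PairWeight
quinvWeight r _ hd z u v _ = (1 ≤ᵇ r) ∧ (r ≤ᵇ hd) ∧ Q (fin z) (withTop r u) (withTop r v)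

unequalWeight : PairWeight
unequalWeight r hc hd z u v w = quinvWeight r hc hd z u v w ∧ (hd <ᵇ hc)

etaWeight : PatternSet → PairWeight
etaWeight S r hc hd z u v w = (hc ≡ᵇ hd) ∧ (1 ≤ᵇ r) ∧ (r ≤ᵇ hc) ∧ QS S z w u v

pairStat-by-terms : ∀ φ L σ (t : ℕ → ℕ → ℕ → ℕ) → (∀ r c d → t r c d ≡ pairTerm φ L σ r c d) →
  (sumTo (nrows L) λ r → sumTo (ncols L) λ c → sumTo (ncols L) λ d → t r c d) ≡ pairStat φ L σ
pairStat-by-terms φ L σ t t≗ =
  sumTo-cong (nrows L) λ r _ _ → sumTo-cong (ncols L) λ c _ _ → sumTo-cong (ncols L) λ d _ _ → t≗ r c d

quinvTriple≡ : ∀ L σ r c d → quinvTriple L σ r c d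
  ≡ (c <ᵇ d) ∧ quinvWeight r (conj L c) (conj L d) (nv L σ (suc r) c) (nv L σ r c) (nv L σ r d) (nv L σ (suc r) d)
quinvTriple≡ L σ r c d rewrite ev≡withTop-nv L σ (suc r) c | ev≡withTop-nv L σ r c | ev≡withTop-nv L σ r d = refl

quinv≡pairStat : ∀ L σ → quinv L σ ≡ pairStat quinvWeight L σ
quinv≡pairStat L σ = pairStat-by-terms quinvWeight L σ _ λ r c d → cong ind (quinvTriple≡ L σ r c d)

quinvUnequal≡pairStat : ∀ L σ → quinvUnequal L σ ≡ pairStat unequalWeight L σ
quinvUnequal≡pairStat L σ = pairStat-by-terms unequalWeight L σ _ λ r c d →
  cong ind (trans (cong (_∧ (conj L d <ᵇ conj L c)) (quinvTriple≡ L σ r c d)) (∧-assoc (c <ᵇ d) _ _))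

six-zero : ∀ S a b → six S 0 0 (suc a) (suc b) ≡ false
six-zero S₁ a b rewrite ∧-zeroʳ (b <ᵇ a) = refl
six-zero S₂ a b rewrite ∧-zeroʳ (a <ᵇ b) = refl
six-zero S₃ a b rewrite ∧-zeroʳ (b <ᵇ a) = refl
six-zero S₄ a b rewrite ∧-zeroʳ (a <ᵇ b) = refl
six-zero S₅ a b rewrite ∧-zeroʳ (b <ᵇ a) = refl
six-zero S₆ a b rewrite ∧-zeroʳ (b <ᵇ a) = refl
six-zero S₇ a b rewrite ∧-zeroʳ (a <ᵇ b) = refl
six-zero S₈ a b rewrite ∧-zeroʳ (a <ᵇ b) = refl

QS-zero : ∀ S {u v} → 0 < u → 0 < v → QS S 0 0 u v ≡ (u <ᵇ v)
QS-zero S {suc a} {suc b} _ _ rewrite six-zero S a b | six-zero S b a | ∧-identityʳ (a <ᵇ b) = ∨-identityʳ (a <ᵇ b)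

Sstar-unequal : ∀ {z w} u v → z ≢ w → Sstar z w u v ≡ false
Sstar-unequal {z} u v z≢w rewrite ≡ᵇ-false z≢w | ∧-zeroʳ (z ≤ᵇ u) | ∧-zeroʳ (u <ᵇ v) = refl

QS-unequal-sym : ∀ S {z w} u v → z ≢ w → QS S z w u v ≡ QS S w z v u
QS-unequal-sym S {z} {w} u v z≢w rewrite Sstar-unequal u v z≢w | Sstar-unequal v u (≢-sym z≢w) =
  ∨-comm (six S z w u v) (six S w z v u)

_==_ : Bool → Bool → Bool
true == b = b
false == b = not b

==-true⇒≡ : ∀ {x y} → (x == y) ≡ true → x ≡ y
==-true⇒≡ {true} {true} _ = refl
==-true⇒≡ {false} {false} _ = refl

==-false⇒≢ : ∀ {x y} → (x == y) ≡ false → x ≢ y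
==-false⇒≢ {true} {false} _ ()
==-false⇒≢ {false} {true} _ ()

condρ : List ℕ → ℕ → Filling → ℕ → Bool
condρ L i σ m = Q (ev L σ m i) (ev L σ (m ∸ 1) i) (ev L σ (m ∸ 1) (suc i))
             == Q (ev L σ m (suc i)) (ev L σ (m ∸ 1) i) (ev L σ (m ∸ 1) (suc i))

-- The comparison used by ρ is local to its definition; unification hands it over.
ρ-comparison : ∀ L i σ → Σ (ℕ → Bool) λ P → ρ L i σ ≡ swapRows i (largest P (conj L i)) (conj L i) σ
ρ-comparison L i σ = _ , refl

ρ-comparison≗condρ : ∀ L i σ m → proj₁ (ρ-comparison L i σ) m ≡ condρ L i σ m
ρ-comparison≗condρ L i σ m with Q (ev L σ m i) (ev L σ (m ∸ 1) i) (ev L σ (m ∸ 1) (suc i))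
... | true = refl
... | false = refl

ρ≡swapRows : ∀ L i σ → ρ L i σ ≡ swapRows i (largest (condρ L i σ) (conj L i)) (conj L i) σ
ρ≡swapRows L i σ = trans (proj₂ (ρ-comparison L i σ))
  (cong (λ k → swapRows i k (conj L i) σ) (largest-cong (conj L i) (ρ-comparison≗condρ L i σ)))

withTop-pos : ∀ {r} v → 1 ≤ r → withTop r v ≡ fin v
withTop-pos {suc r} v _ = refl

nv-inside : ∀ L σ {x c} → x ≤ conj L c → nv L σ x c ≡ σ x c
nv-inside L σ x≤h rewrite <ᵇ-false x≤h = refl

nv-outside : ∀ L σ {x c} → conj L c < x → nv L σ x c ≡ 0
nv-outside L σ h<x rewrite <ᵇ-true h<x = refl

quinvTerm-cong : ∀ L σ σ′ r {c d} →
  nv L σ (suc r) c ≡ nv L σ′ (suc r) c → nv L σ r c ≡ nv L σ′ r c → nv L σ r d ≡ nv L σ′ r d →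
  pairTerm quinvWeight L σ r c d ≡ pairTerm quinvWeight L σ′ r c d
quinvTerm-cong L σ σ′ r z u v rewrite z | u | v = refl

ind-∧-exchange : ∀ g {p q p′ q′} → ind p + ind q ≡ ind p′ + ind q′ →
  ind (g ∧ p) + ind (g ∧ q) ≡ ind (g ∧ p′) + ind (g ∧ q′)
ind-∧-exchange true e = e
ind-∧-exchange false e = refl

-- maj

descentTerm : ℕ → Filling → ℕ → ℕ → ℕ
descentTerm H σ c r = if (2 ≤ᵇ r) ∧ (σ (r ∸ 1) c <ᵇ σ r c) then suc (H ∸ r) else 0

weightedDescents : ℕ → Filling → ℕ → ℕ
weightedDescents H σ c = sumTo H (descentTerm H σ c)

if-as-ind : ∀ b w → (if b then w else 0) ≡ ind b * w
if-as-ind true w = sym (+-identityʳ w)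
if-as-ind false w = refl

weighted-exchange : ∀ w {p q p′ q′} → ind p + ind q ≡ ind p′ + ind q′ →
  (if p then w else 0) + (if q then w else 0) ≡ (if p′ then w else 0) + (if q′ then w else 0)
weighted-exchange w {p} {q} {p′} {q′} e = begin
  (if p then w else 0) + (if q then w else 0)    ≡⟨ cong₂ _+_ (if-as-ind p w) (if-as-ind q w) ⟩
  ind p * w + ind q * w                          ≡⟨ sym (*-distribʳ-+ w (ind p) (ind q)) ⟩
  (ind p + ind q) * w                            ≡⟨ cong (_* w) e ⟩
  (ind p′ + ind q′) * w                          ≡⟨ *-distribʳ-+ w (ind p′) (ind q′) ⟩
  ind p′ * w + ind q′ * w                        ≡⟨ sym (cong₂ _+_ (if-as-ind p′ w) (if-as-ind q′ w)) ⟩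
  (if p′ then w else 0) + (if q′ then w else 0)  ∎
  where open ≡-Reasoning

module MajSwap (L : List ℕ) (i : ℕ) (equal-heights : conj L i ≡ conj L (suc i)) (σ : Filling) (k : ℕ) where
  open ColumnSwap L i equal-heights σ k

  DescentsBalanced : Set
  DescentsBalanced = ∀ r → 1 ≤ r → suc r ≡ k →
    ind (σ r i <ᵇ σ (suc r) i) + ind (σ r (suc i) <ᵇ σ (suc r) (suc i))
    ≡ ind (σ r i <ᵇ σ (suc r) (suc i)) + ind (σ r (suc i) <ᵇ σ (suc r) i)

  descents-swap : DescentsBalanced → ∀ r → r ≤ h →
    descentTerm h τ i r + descentTerm h τ (suc i) r ≡ descentTerm h σ i r + descentTerm h σ (suc i) r
  descents-swap balanced zero _ = refl
  descents-swap balanced (suc zero) _ = refl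
  descents-swap balanced (suc (suc m)) r≤h with <-cmp (suc (suc m)) k
  ... | tri< r<k _ _
    rewrite swapRows-below i k h σ {suc m} i (<-trans (n<1+n _) r<k)
          | swapRows-below i k h σ {suc m} (suc i) (<-trans (n<1+n _) r<k)
          | swapRows-below i k h σ i r<k | swapRows-below i k h σ (suc i) r<k = refl
  ... | tri≈ _ r≡k _
    rewrite swapRows-below i k h σ {suc m} i (subst (suc m <_) r≡k (n<1+n _))
          | swapRows-below i k h σ {suc m} (suc i) (subst (suc m <_) r≡k (n<1+n _))
          | swapRows-inside i k h σ i (≤-reflexive (sym r≡k)) r≤h
          | swapRows-inside i k h σ (suc i) (≤-reflexive (sym r≡k)) r≤h
          | colSwap-left i | colSwap-right i
    = weighted-exchange (suc (h ∸ suc (suc m)))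
        {σ (suc m) i <ᵇ σ (suc (suc m)) (suc i)} {σ (suc m) (suc i) <ᵇ σ (suc (suc m)) i}
        {σ (suc m) i <ᵇ σ (suc (suc m)) i} {σ (suc m) (suc i) <ᵇ σ (suc (suc m)) (suc i)}
        (sym (balanced (suc m) (s≤s z≤n) r≡k))
  ... | tri> _ _ k<r
    rewrite swapRows-inside i k h σ i (≤-pred k<r) (<⇒≤ r≤h)
          | swapRows-inside i k h σ (suc i) (≤-pred k<r) (<⇒≤ r≤h)
          | swapRows-inside i k h σ i (<⇒≤ k<r) r≤h | swapRows-inside i k h σ (suc i) (<⇒≤ k<r) r≤h
          | colSwap-left i | colSwap-right i
    = +-comm (descentTerm h σ (suc i) (suc (suc m))) (descentTerm h σ i (suc (suc m)))

  maj-swap : 1 ≤ i → suc i ≤ ncols L → DescentsBalanced → maj L τ ≡ maj L σ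
  maj-swap 1≤i 1+i≤n balanced = sumTo-cong-except-pair (ncols L) i 1≤i 1+i≤n other paired
    where
    other : ∀ c → 1 ≤ c → c ≤ ncols L → c ≢ i → c ≢ suc i →
      weightedDescents (conj L c) τ c ≡ weightedDescents (conj L c) σ c
    other c _ _ c≢i c≢1+i = sumTo-cong (conj L c) λ r _ _ →
      cong₂ (λ u v → if (2 ≤ᵇ r) ∧ (u <ᵇ v) then suc (conj L c ∸ r) else 0)
        (swapRows-other i k h σ c≢i c≢1+i) (swapRows-other i k h σ c≢i c≢1+i)
    atHeight : ∀ s → weightedDescents (conj L (suc i)) s (suc i) ≡ weightedDescents h s (suc i)
    atHeight s = cong (λ H → weightedDescents H s (suc i)) (sym equal-heights)
    paired : weightedDescents h τ i + weightedDescents (conj L (suc i)) τ (suc i)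
           ≡ weightedDescents h σ i + weightedDescents (conj L (suc i)) σ (suc i)
    paired = begin
      weightedDescents h τ i + weightedDescents (conj L (suc i)) τ (suc i)
        ≡⟨ cong₂ _+_ refl (atHeight τ) ⟩
      weightedDescents h τ i + weightedDescents h τ (suc i)
        ≡⟨ sym (sumTo-distrib-+ h (descentTerm h τ i) (descentTerm h τ (suc i))) ⟩
      sumTo h (λ r → descentTerm h τ i r + descentTerm h τ (suc i) r)
        ≡⟨ sumTo-cong h (λ r _ r≤h → descents-swap balanced r r≤h) ⟩
      sumTo h (λ r → descentTerm h σ i r + descentTerm h σ (suc i) r)
        ≡⟨ sumTo-distrib-+ h (descentTerm h σ i) (descentTerm h σ (suc i)) ⟩
      weightedDescents h σ i + weightedDescents h σ (suc i)
        ≡⟨ cong₂ _+_ refl (sym (atHeight σ)) ⟩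
      weightedDescents h σ i + weightedDescents (conj L (suc i)) σ (suc i) ∎
      where open ≡-Reasoning

-- Two columns of equal height

module EqualColumns (L : List ℕ) (i : ℕ) (equal-heights : conj L i ≡ conj L (suc i)) (σ : Filling)
  (1≤i : 1 ≤ i) (1+i≤n : suc i ≤ ncols L) (1≤h : 1 ≤ conj L i) (h≤N : conj L i ≤ nrows L)
  (top-i : 0 < σ (conj L i) i) (top-i+1 : 0 < σ (conj L i) (suc i)) where

  h : ℕ
  h = conj L i

  ascent descent : ℕ
  ascent = ind (σ h i <ᵇ σ h (suc i))
  descent = ind (σ h (suc i) <ᵇ σ h i)

  i<1+i : i < suc i
  i<1+i = n<1+n i

  r≤h⇒≤conj : ∀ {r} → r ≤ h → r ≤ conj L (suc i)
  r≤h⇒≤conj r≤h = subst (_ ≤_) equal-heights r≤h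

  quinvTerm-inner : ∀ s r → 1 ≤ r → r ≤ h → pairTerm quinvWeight L s r i (suc i)
    ≡ ind (Q (fin (nv L s (suc r) i)) (fin (nv L s r i)) (fin (nv L s r (suc i))))
  quinvTerm-inner s r 1≤r r≤h
    rewrite <ᵇ-true i<1+i | ≤ᵇ-true 1≤r | ≤ᵇ-true (r≤h⇒≤conj r≤h)
          | withTop-pos (nv L s r i) 1≤r | withTop-pos (nv L s r (suc i)) 1≤r = refl

  quinvTerm-inner-above : ∀ s r → 1 ≤ r → h < r → pairTerm quinvWeight L s r i (suc i) ≡ 0
  quinvTerm-inner-above s r 1≤r h<r
    rewrite <ᵇ-true i<1+i | ≤ᵇ-true 1≤r | ≤ᵇ-false (subst (_< r) equal-heights h<r) = refl

  etaTerm-inner : ∀ S s r → 1 ≤ r → r ≤ h → pairTerm (etaWeight S) L s r i (suc i)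
    ≡ ind (QS S (nv L s (suc r) i) (nv L s (suc r) (suc i)) (nv L s r i) (nv L s r (suc i)))
  etaTerm-inner S s r 1≤r r≤h
    rewrite <ᵇ-true i<1+i | sym equal-heights | ≡ᵇ-true (refl {x = h}) | ≤ᵇ-true 1≤r | ≤ᵇ-true r≤h = refl

  etaTerm-inner-above : ∀ S s r → 1 ≤ r → h < r → pairTerm (etaWeight S) L s r i (suc i) ≡ 0
  etaTerm-inner-above S s r 1≤r h<r
    rewrite <ᵇ-true i<1+i | sym equal-heights | ≡ᵇ-true (refl {x = h}) | ≤ᵇ-true 1≤r | ≤ᵇ-false h<r = refl

  unequalTerm-inner : ∀ s r → pairTerm unequalWeight L s r i (suc i) ≡ 0
  unequalTerm-inner s r rewrite <ᵇ-false (≤-reflexive equal-heights)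
    | ∧-zeroʳ (quinvWeight r h (conj L (suc i)) (nv L s (suc r) i) (nv L s r i) (nv L s r (suc i)) (nv L s (suc r) (suc i)))
    | ∧-zeroʳ (i <ᵇ suc i) = refl

  module AtSwapPoint (k : ℕ) (k≤h : k ≤ h) where
    open ColumnSwap L i equal-heights σ k hiding (h)

    top-σ : nv L σ h i ≡ σ h i
    top-σ = nv-inside L σ ≤-refl
    top-σ′ : nv L σ h (suc i) ≡ σ h (suc i)
    top-σ′ = nv-inside L σ (r≤h⇒≤conj ≤-refl)
    top-τ : nv L τ h i ≡ σ h (suc i)
    top-τ = trans (nv-swap-above h i k≤h) (trans (cong (nv L σ h) (colSwap-left i)) top-σ′)
    top-τ′ : nv L τ h (suc i) ≡ σ h i
    top-τ′ = trans (nv-swap-above h (suc i) k≤h) (trans (cong (nv L σ h) (colSwap-right i)) top-σ)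

    quinvTerm-top : pairTerm quinvWeight L σ h i (suc i) + descent ≡ pairTerm quinvWeight L τ h i (suc i) + ascent
    quinvTerm-top
      rewrite quinvTerm-inner σ h 1≤h ≤-refl | quinvTerm-inner τ h 1≤h ≤-refl
            | nv-outside L σ {suc h} {i} (n<1+n h) | nv-outside L τ {suc h} {i} (n<1+n h)
            | top-σ | top-σ′ | top-τ | top-τ′
            | Q-zero (σ h i) (σ h (suc i)) top-i top-i+1 | Q-zero (σ h (suc i)) (σ h i) top-i+1 top-i
      = +-comm ascent descent

    etaTerm-top : ∀ S → pairTerm (etaWeight S) L σ h i (suc i) + descent ≡ pairTerm (etaWeight S) L τ h i (suc i) + ascent
    etaTerm-top S
      rewrite etaTerm-inner S σ h 1≤h ≤-refl | etaTerm-inner S τ h 1≤h ≤-refl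
            | nv-outside L σ {suc h} {i} (n<1+n h) | nv-outside L τ {suc h} {i} (n<1+n h)
            | nv-outside L σ {suc h} {suc i} (subst (_< suc h) equal-heights (n<1+n h))
            | nv-outside L τ {suc h} {suc i} (subst (_< suc h) equal-heights (n<1+n h))
            | top-σ | top-σ′ | top-τ | top-τ′
            | QS-zero S top-i top-i+1 | QS-zero S top-i+1 top-i
      = +-comm ascent descent

  module RhoSwap where
    k : ℕ
    k = largest (condρ L i σ) h

    k≤h : k ≤ h
    k≤h = largest-≤ (condρ L i σ) h 1≤h

    open ColumnSwap L i equal-heights σ k hiding (h)
    open PairSwap quinvWeight L i equal-heights σ k
    open AtSwapPoint k k≤h

    Qᵢ Qᵢ₊₁ : ℕ → Bool
    Qᵢ r = Q (fin (nv L σ (suc r) i)) (fin (nv L σ r i)) (fin (nv L σ r (suc i)))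
    Qᵢ₊₁ r = Q (fin (nv L σ (suc r) (suc i))) (fin (nv L σ r i)) (fin (nv L σ r (suc i)))

    condρ-nv : ∀ r → 1 ≤ r → condρ L i σ (suc r) ≡ (Qᵢ r == Qᵢ₊₁ r)
    condρ-nv r 1≤r rewrite ev≡withTop-nv L σ (suc r) i | ev≡withTop-nv L σ (suc r) (suc i)
      | ev≡withTop-nv L σ r i | ev≡withTop-nv L σ r (suc i)
      | withTop-pos (nv L σ r i) 1≤r | withTop-pos (nv L σ r (suc i)) 1≤r = refl

    cond-at : ∀ r → 1 ≤ r → suc r ≡ k → Qᵢ r ≡ Qᵢ₊₁ r
    cond-at r 1≤r 1+r≡k = ==-true⇒≡ (trans (sym (condρ-nv r 1≤r))
      (subst (λ m → condρ L i σ m ≡ true) (sym 1+r≡k) (largest-holds (condρ L i σ) h (subst (2 ≤_) 1+r≡k (s≤s 1≤r)))))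

    cond-above : ∀ r → 1 ≤ r → k < suc r → suc r ≤ h → Qᵢ r ≢ Qᵢ₊₁ r
    cond-above r 1≤r k<1+r 1+r≤h =
      ==-false⇒≢ (trans (sym (condρ-nv r 1≤r)) (largest-maximal (condρ L i σ) h (suc r) k<1+r 1+r≤h))

    mixed : ∀ r → 1 ≤ r → suc r ≡ k → PairsBalanced r
    mixed r 1≤r 1+r≡k = left , right
      where
      left : ∀ c → c < i → pairTerm quinvWeight L σ r c i + pairTerm quinvWeight L σ r c (suc i)
                         ≡ pairTerm quinvWeight L τ r c i + pairTerm quinvWeight L τ r c (suc i)
      left c c<i = sym (cong₂ _+_ (unchanged i) (unchanged (suc i)))
        where
        unchanged : ∀ e → pairTerm quinvWeight L τ r c e ≡ pairTerm quinvWeight L σ r c e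
        unchanged e = quinvTerm-cong L τ σ r
          (nv-swap-other (suc r) (<⇒≢ c<i) (<⇒≢ (m<n⇒m<1+n c<i)))
          (nv-swap-below r c (suc≡⇒< 1+r≡k)) (nv-swap-below r e (suc≡⇒< 1+r≡k))
      right : ∀ d → suc i < d → pairTerm quinvWeight L σ r i d + pairTerm quinvWeight L σ r (suc i) d
                              ≡ pairTerm quinvWeight L τ r i d + pairTerm quinvWeight L τ r (suc i) d
      right d 1+i<d
        rewrite nv-swap-above (suc r) i (≤-reflexive (sym 1+r≡k)) | colSwap-left i
              | nv-swap-above (suc r) (suc i) (≤-reflexive (sym 1+r≡k)) | colSwap-right i
              | nv-swap-below r i (suc≡⇒< 1+r≡k) | nv-swap-below r (suc i) (suc≡⇒< 1+r≡k)
              | nv-swap-below r d (suc≡⇒< 1+r≡k)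
              | <ᵇ-true (<-trans i<1+i 1+i<d) | <ᵇ-true 1+i<d | ≤ᵇ-true 1≤r
              | withTop-pos (nv L σ r i) 1≤r | withTop-pos (nv L σ r (suc i)) 1≤r | withTop-pos (nv L σ r d) 1≤r
        = ind-∧-exchange (r ≤ᵇ conj L d)
            (Q-exchange (nv L σ (suc r) i) (nv L σ (suc r) (suc i)) (nv L σ r i) (nv L σ r (suc i)) (nv L σ r d)
             (cond-at r 1≤r 1+r≡k))

    inner : ∀ r → 1 ≤ r → r ≤ nrows L → r ≢ h →
      pairTerm quinvWeight L σ r i (suc i) ≡ pairTerm quinvWeight L τ r i (suc i)
    inner r 1≤r _ r≢h with <-cmp r h
    ... | tri> _ _ h<r = trans (quinvTerm-inner-above σ r 1≤r h<r) (sym (quinvTerm-inner-above τ r 1≤r h<r))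
    ... | tri≈ _ r≡h _ = ⊥-elim (r≢h r≡h)
    ... | tri< r<h _ _
      rewrite quinvTerm-inner σ r 1≤r (<⇒≤ r<h) | quinvTerm-inner τ r 1≤r (<⇒≤ r<h) = cong ind (compare (<-cmp (suc r) k))
      where
      compare : Tri (suc r < k) (suc r ≡ k) (k < suc r) →
        Qᵢ r ≡ Q (fin (nv L τ (suc r) i)) (fin (nv L τ r i)) (fin (nv L τ r (suc i)))
      compare (tri< 1+r<k _ _)
        rewrite nv-swap-below (suc r) i 1+r<k | nv-swap-below r i (<-trans (n<1+n r) 1+r<k)
              | nv-swap-below r (suc i) (<-trans (n<1+n r) 1+r<k) = refl
      compare (tri≈ _ 1+r≡k _)
        rewrite nv-swap-above (suc r) i (≤-reflexive (sym 1+r≡k)) | colSwap-left i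
              | nv-swap-below r i (suc≡⇒< 1+r≡k) | nv-swap-below r (suc i) (suc≡⇒< 1+r≡k) = cond-at r 1≤r 1+r≡k
      compare (tri> _ _ k<1+r)
        rewrite nv-swap-above (suc r) i (<⇒≤ k<1+r) | nv-swap-above r i (≤-pred k<1+r)
              | nv-swap-above r (suc i) (≤-pred k<1+r) | colSwap-left i | colSwap-right i =
        Q-unequal⇒swap (nv L σ (suc r) i) (nv L σ (suc r) (suc i)) (nv L σ r i) (nv L σ r (suc i))
          (cond-above r 1≤r k<1+r r<h)

    quinv-ρ : quinv L σ + descent ≡ quinv L (ρ L i σ) + ascent
    quinv-ρ = begin
      quinv L σ + descent                 ≡⟨ cong (_+ descent) (quinv≡pairStat L σ) ⟩
      pairStat quinvWeight L σ + descent  ≡⟨ pairStat-swap descent ascent 1≤i 1+i≤n 1≤h h≤N mixed inner quinvTerm-top ⟩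
      pairStat quinvWeight L τ + ascent   ≡⟨ cong (_+ ascent) (sym (quinv≡pairStat L τ)) ⟩
      quinv L τ + ascent                  ≡⟨ cong (λ s → quinv L s + ascent) (sym (ρ≡swapRows L i σ)) ⟩
      quinv L (ρ L i σ) + ascent          ∎
      where open ≡-Reasoning

    maj-ρ : maj L (ρ L i σ) ≡ maj L σ
    maj-ρ = trans (cong (maj L) (ρ≡swapRows L i σ)) (MajSwap.maj-swap L i equal-heights σ k 1≤i 1+i≤n descents)
      where
      descents : MajSwap.DescentsBalanced L i equal-heights σ k
      descents r 1≤r 1+r≡k = descent-exchange (σ (suc r) i) (σ (suc r) (suc i)) (σ r i) (σ r (suc i)) cond
        where
        1+r≤h : suc r ≤ h
        1+r≤h = subst (_≤ h) (sym 1+r≡k) k≤h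
        cond : Q (fin (σ (suc r) i)) (fin (σ r i)) (fin (σ r (suc i)))
             ≡ Q (fin (σ (suc r) (suc i))) (fin (σ r i)) (fin (σ r (suc i)))
        cond rewrite sym (nv-inside L σ {suc r} {i} 1+r≤h) | sym (nv-inside L σ {suc r} {suc i} (r≤h⇒≤conj 1+r≤h))
                   | sym (nv-inside L σ {r} {i} (<⇒≤ 1+r≤h)) | sym (nv-inside L σ {r} {suc i} (r≤h⇒≤conj (<⇒≤ 1+r≤h)))
          = cond-at r 1≤r 1+r≡k

  module DeltaSwap where
    sameAt : ℕ → Bool
    sameAt m = σ m i ≡ᵇ σ m (suc i)

    k : ℕ
    k = largest sameAt h

    k≤h : k ≤ h
    k≤h = largest-≤ sameAt h 1≤h

    open ColumnSwap L i equal-heights σ k hiding (h)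
    open AtSwapPoint k k≤h

    same-at : ∀ r → suc r ≡ k → 1 ≤ r → σ (suc r) i ≡ σ (suc r) (suc i)
    same-at r 1+r≡k 1≤r = ≡ᵇ-true⇒≡ (subst (λ m → sameAt m ≡ true) (sym 1+r≡k)
      (largest-holds sameAt h (subst (2 ≤_) 1+r≡k (s≤s 1≤r))))

    differ-above : ∀ m → k < m → m ≤ h → σ m i ≢ σ m (suc i)
    differ-above m k<m m≤h e with () ← trans (sym (≡ᵇ-true e)) (largest-maximal sameAt h m k<m m≤h)

    same-nv : ∀ r → 1 ≤ r → suc r ≡ k → nv L σ (suc r) i ≡ nv L σ (suc r) (suc i)
    same-nv r 1≤r 1+r≡k rewrite same-at r 1+r≡k 1≤r | equal-heights = refl

    -- δ starts its swap at a row where the two columns agree, so that row is not changed.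
    row-k-fixed : ∀ r → 1 ≤ r → suc r ≡ k → ∀ c → nv L σ (suc r) c ≡ nv L τ (suc r) c
    row-k-fixed r 1≤r 1+r≡k c with c ≟ i | c ≟ suc i
    ... | yes refl | _ = trans (same-nv r 1≤r 1+r≡k) (sym (trans (nv-swap-above (suc r) c (≤-reflexive (sym 1+r≡k)))
                                                                (cong (nv L σ (suc r)) (colSwap-left i))))
    ... | no _ | yes refl = sym (trans (nv-swap-above (suc r) c (≤-reflexive (sym 1+r≡k)))
                                  (trans (cong (nv L σ (suc r)) (colSwap-right i)) (same-nv r 1≤r 1+r≡k)))
    ... | no c≢i | no c≢1+i = sym (nv-swap-other (suc r) c≢i c≢1+i)

    row-below-fixed : ∀ r → r < k → ∀ c → nv L σ r c ≡ nv L τ r c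
    row-below-fixed r r<k c = sym (nv-swap-below r c r<k)

    upper-differ : ∀ m → k < m → m ≤ h → nv L σ m i ≢ nv L σ m (suc i)
    upper-differ m k<m m≤h rewrite nv-inside L σ {m} {i} m≤h | nv-inside L σ {m} {suc i} (r≤h⇒≤conj m≤h) =
      differ-above m k<m m≤h

    mixed : ∀ φ r → 1 ≤ r → suc r ≡ k → PairSwap.PairsBalanced φ L i equal-heights σ k r
    mixed φ r 1≤r 1+r≡k =
      PairSwap.balanced-rows-fixed φ L i equal-heights σ k (row-k-fixed r 1≤r 1+r≡k) (row-below-fixed r (suc≡⇒< 1+r≡k))

    etaInner : ∀ S r → 1 ≤ r → r ≤ nrows L → r ≢ h →
      pairTerm (etaWeight S) L σ r i (suc i) ≡ pairTerm (etaWeight S) L τ r i (suc i)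
    etaInner S r 1≤r _ r≢h with <-cmp r h
    ... | tri> _ _ h<r = trans (etaTerm-inner-above S σ r 1≤r h<r) (sym (etaTerm-inner-above S τ r 1≤r h<r))
    ... | tri≈ _ r≡h _ = ⊥-elim (r≢h r≡h)
    ... | tri< r<h _ _ with <-cmp (suc r) k
    ...   | tri< 1+r<k _ _ = sym (PairSwap.pairTerm-below (etaWeight S) L i equal-heights σ k r i (suc i) 1+r<k)
    ...   | tri≈ _ 1+r≡k _ = pairTerm-cong (etaWeight S) L σ τ r
      (row-k-fixed r 1≤r 1+r≡k i) (row-below-fixed r (suc≡⇒< 1+r≡k) i)
      (row-below-fixed r (suc≡⇒< 1+r≡k) (suc i)) (row-k-fixed r 1≤r 1+r≡k (suc i))
    ...   | tri> _ _ k<1+r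
      rewrite etaTerm-inner S σ r 1≤r (<⇒≤ r<h) | etaTerm-inner S τ r 1≤r (<⇒≤ r<h)
            | nv-swap-above (suc r) i (<⇒≤ k<1+r) | nv-swap-above (suc r) (suc i) (<⇒≤ k<1+r)
            | nv-swap-above r i (≤-pred k<1+r) | nv-swap-above r (suc i) (≤-pred k<1+r)
            | colSwap-left i | colSwap-right i
      = cong ind (QS-unequal-sym S (nv L σ r i) (nv L σ r (suc i)) (upper-differ (suc r) k<1+r r<h))

    etaS-δ : ∀ S → etaS S L σ + descent ≡ etaS S L (δ L i σ) + ascent
    etaS-δ S = PairSwap.pairStat-swap (etaWeight S) L i equal-heights σ k descent ascent 1≤i 1+i≤n 1≤h h≤N
      (mixed (etaWeight S)) (etaInner S) (etaTerm-top S)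

    quinvUnequal-δ : quinvUnequal L σ ≡ quinvUnequal L (δ L i σ)
    quinvUnequal-δ = begin
      quinvUnequal L σ           ≡⟨ quinvUnequal≡pairStat L σ ⟩
      pairStat unequalWeight L σ ≡⟨ +-cancelʳ-≡ 0 _ _ swapped ⟩
      pairStat unequalWeight L τ ≡⟨ sym (quinvUnequal≡pairStat L τ) ⟩
      quinvUnequal L τ           ∎
      where
      open ≡-Reasoning
      no-inner : ∀ r → pairTerm unequalWeight L σ r i (suc i) ≡ pairTerm unequalWeight L τ r i (suc i)
      no-inner r = trans (unequalTerm-inner σ r) (sym (unequalTerm-inner τ r))
      swapped : pairStat unequalWeight L σ + 0 ≡ pairStat unequalWeight L τ + 0
      swapped = PairSwap.pairStat-swap unequalWeight L i equal-heights σ k 0 0 1≤i 1+i≤n 1≤h h≤N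
        (mixed unequalWeight) (λ r _ _ _ → no-inner r) (cong (_+ 0) (no-inner h))

    eta-δ : ∀ S → eta S L σ + descent ≡ eta S L (δ L i σ) + ascent
    eta-δ S = begin
      etaS S L σ + quinvUnequal L σ + descent  ≡⟨ cong (λ u → etaS S L σ + u + descent) quinvUnequal-δ ⟩
      etaS S L σ + quinvUnequal L τ + descent  ≡⟨ xy∙z≈xz∙y (etaS S L σ) (quinvUnequal L τ) descent ⟩
      etaS S L σ + descent + quinvUnequal L τ  ≡⟨ cong (_+ quinvUnequal L τ) (etaS-δ S) ⟩
      etaS S L τ + ascent + quinvUnequal L τ   ≡⟨ xy∙z≈xz∙y (etaS S L τ) ascent (quinvUnequal L τ) ⟩
      etaS S L τ + quinvUnequal L τ + ascent   ∎
      where open ≡-Reasoning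

    maj-δ : maj L (δ L i σ) ≡ maj L σ
    maj-δ = MajSwap.maj-swap L i equal-heights σ k 1≤i 1+i≤n descents
      where
      descents : MajSwap.DescentsBalanced L i equal-heights σ k
      descents r 1≤r 1+r≡k rewrite same-at r 1+r≡k 1≤r = refl

ncols-tail≤head : ∀ {p ps} → Linked (λ a b → b ≤ a) (p ∷ ps) → ncols ps ≤ p
ncols-tail≤head [-] = z≤n
ncols-tail≤head (q≤p ∷ _) = q≤p

column≤ncols : ∀ L c → Linked (λ a b → b ≤ a) L → 0 < conj L c → c ≤ ncols L
column≤ncols (p ∷ ps) c decreasing nonempty with c ≤ᵇ p in c≤ᵇp
... | true = ≤ᵇ⇒≤ c p (subst T (sym c≤ᵇp) _)
... | false = ≤-trans (column≤ncols ps c (Linked.tail decreasing) nonempty) (ncols-tail≤head decreasing)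

conj≤nrows : ∀ L c → conj L c ≤ nrows L
conj≤nrows L c = length-filter (c ≤?_) L

⊖-balanced : ∀ x x′ a b → x + a ≡ x′ + b → x ⊖ x′ ≡ b ⊖ a
⊖-balanced x x′ a b e = begin
  x ⊖ x′                 ≡⟨ sym (+-cancelˡ-⊖ a x x′) ⟩
  (a + x) ⊖ (a + x′)     ≡⟨ cong₂ _⊖_ (trans (+-comm a x) e) (+-comm a x′) ⟩
  (x′ + b) ⊖ (x′ + a)    ≡⟨ +-cancelˡ-⊖ x′ b a ⟩
  b ⊖ a                  ∎
  where open ≡-Reasoning

lemma4p5 : (lam : List ℕ) → IsPartition lam
  → (i : ℕ) → 1 ≤ i → 0 < conj lam i → conj lam i ≡ conj lam (suc i)
  → (σ : Filling) → IsFilling lam σ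
  → (S : PatternSet)
  → ((+ quinv lam σ) - (+ quinv lam (ρ lam i σ))
       ≡ (+ eta S lam σ) - (+ eta S lam (δ lam i σ)))
    × (maj lam (ρ lam i σ) ≡ maj lam (δ lam i σ))
lemma4p5 L (_ , decreasing) i 1≤i 1≤h equal-heights σ filling S =
  (begin
    + quinv L σ - + quinv L (ρ L i σ)      ≡⟨ [+m]-[+n]≡m⊖n (quinv L σ) (quinv L (ρ L i σ)) ⟩
    quinv L σ ⊖ quinv L (ρ L i σ)          ≡⟨ ⊖-balanced (quinv L σ) (quinv L (ρ L i σ)) descent ascent RhoSwap.quinv-ρ ⟩
    ascent ⊖ descent                       ≡⟨ sym (⊖-balanced (eta S L σ) (eta S L (δ L i σ)) descent ascent (DeltaSwap.eta-δ S)) ⟩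
    eta S L σ ⊖ eta S L (δ L i σ)          ≡⟨ sym ([+m]-[+n]≡m⊖n (eta S L σ) (eta S L (δ L i σ))) ⟩
    + eta S L σ - + eta S L (δ L i σ)      ∎)
  , trans RhoSwap.maj-ρ (sym DeltaSwap.maj-δ)
  where
  open ≡-Reasoning
  open EqualColumns L i equal-heights σ 1≤i
    (column≤ncols L (suc i) decreasing (subst (0 <_) equal-heights 1≤h)) 1≤h (conj≤nrows L i)
    (filling _ i 1≤i 1≤h ≤-refl) (filling _ (suc i) (s≤s z≤n) 1≤h (≤-reflexive equal-heights))
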